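{- Let $a_1,\dots,a_n$ be positive integers with $\gcd(a_1,\dots,a_n)=1$, $m=\sum_ia_i$, $k=\lceil\log m\rceil$. For integers $K\ge k$ let $c_K=\lfloor2^K/m\rfloor$ and $Q_K=(q_{K,0},q_{K,1},\dots,q_{K,n})$ with $q_{K,0}=1-c_Km/2^K$ and $q_{K,i}=c_Ka_i/2^K$ for $1\le i\le n$. If $Q_{K+1}\ne Q_K$, then $q_{K+1,0}<q_{K,0}$.
   Context: All logarithms are base 2. -}

module Defs where

open import Data.Nat using (ℕ; zero; suc; _^_; _*_)
open import Data.Nat.DivMod using (_/_)
open import Data.Nat.GCD using (gcd)
open import Data.Nat.Properties using (m^n≢0)
open import Data.Vec using (Vec; []; _∷_; map; sum)
open import Data.Integer using (+_)
open import Data.Rational as ℚ using (ℚ; 1ℚ; _-_)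

gcdVec : ∀ {n} → Vec ℕ n → ℕ
gcdVec []       = 0
gcdVec (x ∷ xs) = gcd x (gcdVec xs)

msum : ∀ {n} → Vec ℕ n → ℕ
msum = sum

-- floor division x / m on ℕ; the m = 0 branch is never used under the
-- theorem's hypotheses (m ≥ 1 since all a_i are positive and gcd = 1)
divℕ : ℕ → ℕ → ℕ
divℕ x zero    = 0
divℕ x (suc m) = x / suc m

over2^ : ℕ → ℕ → ℚ
over2^ x K = ℚ._/_ (+ x) (2 ^ K) {{m^n≢0 2 K}}

cK : ∀ {n} → Vec ℕ n → ℕ → ℕ
cK a K = divℕ (2 ^ K) (msum a)

q0 : ∀ {n} → Vec ℕ n → ℕ → ℚ
q0 a K = 1ℚ - over2^ (cK a K * msum a) K

qi : ∀ {n} → Vec ℕ n → ℕ → ℕ → ℚ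
qi a K ai = over2^ (cK a K * ai) K

QK : ∀ {n} → Vec ℕ n → ℕ → Vec ℚ (suc n)
QK a K = q0 a K ∷ map (qi a K) a

-- Doubling 2^K to 2^(K+1) turns c_K into c_{K+1} ∈ {2 c_K, 2 c_K + 1}, since
-- ⌊2x/m⌋ is 2⌊x/m⌋ or 2⌊x/m⌋ + 1.  In the first case every entry
-- c_{K+1} a_i / 2^(K+1) equals c_K a_i / 2^K, so Q_{K+1} = Q_K; in the second,
-- c_{K+1} m / 2^(K+1) = (2 c_K m + m) / 2^(K+1) > c_K m / 2^K, so q_0 drops.
module Submission where

open import Defs
open import Data.Nat using (ℕ; suc; _<_; _≤_)
open import Data.Nat.Logarithm using (⌈log₂_⌉)
open import Data.Fin using (Fin)
open import Data.Vec using (Vec; lookup)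
open import Data.Rational as ℚ using (ℚ)
open import Relation.Binary.PropositionalEquality using (_≡_; _≢_)

open import Data.Empty using (⊥-elim)
open import Data.Integer as ℤ using (+_)
import Data.Integer.Properties as ℤ
open import Data.Nat as ℕ using (zero; _*_; _+_; _^_; NonZero)
open import Data.Nat.DivMod using (_/_; m≡m%n+[m/n]*n; m%n<n; m/n*n≤m; m<n*o⇒m/o<n; /-monoˡ-≤; m*n/n≡m)
import Data.Nat.Properties as ℕ
open import Data.Nat.Solver using (module +-*-Solver)
open import Data.Product using (_×_; _,_)
open import Data.Rational.Unnormalised using (mkℚᵘ; *≡*; *<*)
import Data.Rational.Unnormalised.Properties as ℚᵘ
import Data.Rational.Properties as ℚ
open import Data.Sum using (_⊎_; inj₁; inj₂; map₂)
open import Data.Vec using (_∷_)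
open import Data.Vec.Properties using (map-cong)
open import Relation.Binary.PropositionalEquality using (refl; sym; cong; cong₂; subst; subst₂; module ≡-Reasoning)
open +-*-Solver using (solve; _:=_; _:*_; _:+_; con)

≤∧<2+⇒≡∨≡suc : ∀ {m n} → m ≤ n → n < 2 + m → n ≡ m ⊎ n ≡ suc m
≤∧<2+⇒≡∨≡suc m≤n n<2+m with ℕ.m≤n⇒m<n∨m≡n m≤n
... | inj₁ m<n = inj₂ (ℕ.≤-antisym (ℕ.≤-pred n<2+m) m<n)
... | inj₂ m≡n = inj₁ (sym m≡n)

m*[n/o]≤m*n/o : ∀ m n o .{{_ : NonZero o}} → m * (n / o) ≤ (m * n) / o
m*[n/o]≤m*n/o m n o = subst (_≤ (m * n) / o) (m*n/n≡m (m * (n / o)) o) (/-monoˡ-≤ o m*[n/o]*o≤m*n)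
  where
  m*[n/o]*o≤m*n : m * (n / o) * o ≤ m * n
  m*[n/o]*o≤m*n = subst (_≤ m * n) (sym (ℕ.*-assoc m (n / o) o)) (ℕ.*-monoʳ-≤ m (m/n*n≤m n o))

m*n/o<m+m*[n/o] : ∀ m n o .{{_ : NonZero m}} .{{_ : NonZero o}} → (m * n) / o < m + m * (n / o)
m*n/o<m+m*[n/o] m n o = m<n*o⇒m/o<n m*n<[m+m*[n/o]]*o
  where
  q = n / o
  n<[1+q]*o : n < suc q * o
  n<[1+q]*o = subst (_< suc q * o) (sym (m≡m%n+[m/n]*n n o)) (ℕ.+-monoˡ-< (q * o) (m%n<n n o))
  m*n<[m+m*[n/o]]*o : m * n < (m + m * q) * o
  m*n<[m+m*[n/o]]*o = subst (m * n <_) (solve 3 (λ m q o → m :* ((con 1 :+ q) :* o) := (m :+ m :* q) :* o) refl m q o)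
                        (ℕ.*-monoʳ-< m n<[1+q]*o)

[2*m]/n≡2*[m/n]⊎1+2*[m/n] : ∀ m n .{{_ : NonZero n}} → (2 * m) / n ≡ 2 * (m / n) ⊎ (2 * m) / n ≡ suc (2 * (m / n))
[2*m]/n≡2*[m/n]⊎1+2*[m/n] m n = ≤∧<2+⇒≡∨≡suc (m*[n/o]≤m*n/o 2 m n) (m*n/o<m+m*[n/o] 2 m n)

cK-suc : ∀ {n} (a : Vec ℕ n) K →
         cK a (suc K) ≡ 2 * cK a K ⊎ (NonZero (msum a) × cK a (suc K) ≡ suc (2 * cK a K))
cK-suc a K with msum a
... | zero    = inj₁ refl
... | suc m-1 = map₂ (_ ,_) ([2*m]/n≡2*[m/n]⊎1+2*[m/n] (2 ^ K) (suc m-1))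

+[c*x]/[c*d]≡+x/d : ∀ c x d .{{_ : NonZero c}} .{{_ : NonZero d}} .{{_ : NonZero (c * d)}} →
                    (+ (c * x)) ℚ./ (c * d) ≡ (+ x) ℚ./ d
+[c*x]/[c*d]≡+x/d c@(suc _) x d@(suc d-1) =
  ℚ.fromℚᵘ-cong {mkℚᵘ (+ (c * x)) (ℕ.pred (c * d))} {mkℚᵘ (+ x) d-1} (*≡* (begin
  + (c * x) ℤ.* + d   ≡⟨ ℤ.pos-* (c * x) d ⟨
  + (c * x * d)       ≡⟨ cong +_ (solve 3 (λ c x d → c :* x :* d := x :* (c :* d)) refl c x d) ⟩
  + (x * (c * d))     ≡⟨ ℤ.pos-* x (c * d) ⟩
  + x ℤ.* + (c * d)   ∎))
  where open ≡-Reasoning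

+x/d<+y/d : ∀ {x y} d .{{_ : NonZero d}} → x < y → (+ x) ℚ./ d ℚ.< (+ y) ℚ./ d
+x/d<+y/d {x} {y} (suc d-1) x<y = ℚ.toℚᵘ-cancel-<
  (ℚᵘ.<-respʳ-≃ (ℚᵘ.≃-sym (ℚ.toℚᵘ-fromℚᵘ (mkℚᵘ (+ y) d-1)))
    (ℚᵘ.<-respˡ-≃ (ℚᵘ.≃-sym (ℚ.toℚᵘ-fromℚᵘ (mkℚᵘ (+ x) d-1)))
      (*<* (subst₂ ℤ._<_ (ℤ.pos-* x (suc d-1)) (ℤ.pos-* y (suc d-1)) (ℤ.+<+ (ℕ.*-monoˡ-< (suc d-1) x<y))))))

over2^-double : ∀ x K → over2^ (2 * x) (suc K) ≡ over2^ x K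
over2^-double x K = +[c*x]/[c*d]≡+x/d 2 x (2 ^ K) {{_}} {{ℕ.m^n≢0 2 K}} {{ℕ.m^n≢0 2 (suc K)}}

over2^-monoˡ-< : ∀ {x y} K → x < y → over2^ x K ℚ.< over2^ y K
over2^-monoˡ-< K = +x/d<+y/d (2 ^ K) {{ℕ.m^n≢0 2 K}}

QK-suc≡QK : ∀ {n} (a : Vec ℕ n) K → cK a (suc K) ≡ 2 * cK a K → QK a (suc K) ≡ QK a K
QK-suc≡QK a K c′≡2c = cong₂ _∷_ (cong (λ x → ℚ.1ℚ ℚ.- x) (entry (msum a))) (map-cong entry a)
  where
  open ≡-Reasoning
  entry : ∀ y → over2^ (cK a (suc K) * y) (suc K) ≡ over2^ (cK a K * y) K
  entry y = begin
    over2^ (cK a (suc K) * y) (suc K) ≡⟨ cong (λ c → over2^ (c * y) (suc K)) c′≡2c ⟩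
    over2^ (2 * cK a K * y) (suc K)   ≡⟨ cong (λ z → over2^ z (suc K)) (ℕ.*-assoc 2 (cK a K) y) ⟩
    over2^ (2 * (cK a K * y)) (suc K) ≡⟨ over2^-double (cK a K * y) K ⟩
    over2^ (cK a K * y) K             ∎

q0-suc<q0 : ∀ {n} (a : Vec ℕ n) K .{{_ : NonZero (msum a)}} →
            cK a (suc K) ≡ suc (2 * cK a K) → q0 a (suc K) ℚ.< q0 a K
q0-suc<q0 a K c′≡1+2c = ℚ.+-monoʳ-< ℚ.1ℚ (ℚ.neg-antimono-< c*m/2^K<c′*m/2^[1+K])
  where
  c = cK a K
  m = msum a
  2*[c*m]<c′*m : 2 * (c * m) < cK a (suc K) * m
  2*[c*m]<c′*m = subst₂ _<_ (ℕ.*-assoc 2 c m) (cong (_* m) (sym c′≡1+2c))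
                   (ℕ.m<n+m (2 * c * m) (ℕ.>-nonZero⁻¹ m))
  c*m/2^K<c′*m/2^[1+K] : over2^ (c * m) K ℚ.< over2^ (cK a (suc K) * m) (suc K)
  c*m/2^K<c′*m/2^[1+K] = begin-strict
    over2^ (c * m) K                    ≡⟨ over2^-double (c * m) K ⟨
    over2^ (2 * (c * m)) (suc K)        <⟨ over2^-monoˡ-< (suc K) 2*[c*m]<c′*m ⟩
    over2^ (cK a (suc K) * m) (suc K)   ∎
    where open ℚ.≤-Reasoning

proposition4p4 : (n : ℕ) (a : Vec ℕ n) →
    (∀ (i : Fin n) → 0 < lookup a i) →
    gcdVec a ≡ 1 →
    (K : ℕ) → ⌈log₂ (msum a) ⌉ ≤ K →
    QK a (suc K) ≢ QK a K →
    q0 a (suc K) ℚ.< q0 a K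
proposition4p4 n a _ _ K _ QK-suc≢QK with cK-suc a K
... | inj₁ c′≡2c              = ⊥-elim (QK-suc≢QK (QK-suc≡QK a K c′≡2c))
... | inj₂ (m≢0 , c′≡1+2c) = q0-suc<q0 a K {{m≢0}} c′≡1+2c
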